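{- For graphs $G$ and $H$: (i) $G$ and $H$ are isomorphic if and only if $G^*$ and $H^*$ are isomorphic; (ii) $I(G;x)=I(H;x)$ if and only if $I(G^*;x)=I(H^*;x)$.
   Context: Graphs are finite and simple. A stable set is a set of pairwise non-adjacent vertices; with $s_k$ the number of stable sets of size $k$ in $G$ ($s_0=1$), the independence polynomial is $I(G;x)=\sum_{k\ge 0}s_kx^k$. For a graph $G$ with vertices $v_1,\dots,v_n$, $G^*$ is obtained by adding new vertices $u_1,\dots,u_n$ and edges $u_iv_i$, i.e., attaching one pendant edge to each vertex of $G$. -}

module Defs where

open import Data.Nat using (ℕ; zero; suc; _+_; _≡ᵇ_)
open import Data.Bool using (Bool; true; false; _∧_; _∨_; not; if_then_else_)
open import Data.Fin using (Fin; splitAt)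
open import Data.Fin.Properties using (_≟_)
open import Data.Sum using (_⊎_; inj₁; inj₂)
open import Data.Product using (Σ; _×_; _,_)
open import Data.Vec using (Vec; []; _∷_; lookup)
open import Data.List using (List; []; _∷_; map; _++_; length; filterᵇ; allFin)
open import Function.Bundles using (_↔_; Inverse)
open import Relation.Binary.PropositionalEquality using (_≡_)
open import Relation.Nullary using (¬_; does)
open import Data.Bool.ListAction using (and)

record Graph (n : ℕ) : Set where
  field
    adj       : Fin n → Fin n → Bool
    adj-sym   : ∀ i j → adj i j ≡ adj j i
    adj-irrefl : ∀ i → adj i i ≡ false
open Graph public

record _≅_ {n m : ℕ} (G : Graph n) (H : Graph m) : Set where
  field
    bij      : Fin n ↔ Fin m
    preserves : ∀ i j → adj H (Inverse.to bij i) (Inverse.to bij j) ≡ adj G i j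

-- G* : vertices Fin (n + n); the first n (inj₁ i under splitAt) are v_i, the
-- last n (inj₂ i) are the new vertices u_i; add exactly the edges u_i v_i.
coronaAdj : ∀ {n} → Graph n → Fin n ⊎ Fin n → Fin n ⊎ Fin n → Bool
coronaAdj G (inj₁ i) (inj₁ j) = adj G i j
coronaAdj G (inj₁ i) (inj₂ j) = does (i ≟ j)
coronaAdj G (inj₂ i) (inj₁ j) = does (i ≟ j)
coronaAdj G (inj₂ i) (inj₂ j) = false

private
  open import Relation.Binary.PropositionalEquality using (refl; cong)

  coronaAdj-sym : ∀ {n} (G : Graph n) x y → coronaAdj G x y ≡ coronaAdj G y x
  coronaAdj-sym G (inj₁ i) (inj₁ j) = adj-sym G i j
  coronaAdj-sym G (inj₁ i) (inj₂ j) with i ≟ j | j ≟ i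
  ... | Relation.Nullary.yes _ | Relation.Nullary.yes _ = refl
  ... | Relation.Nullary.no _  | Relation.Nullary.no _  = refl
  ... | Relation.Nullary.yes p | Relation.Nullary.no q  = Data.Empty.⊥-elim (q (Relation.Binary.PropositionalEquality.sym p))
    where import Data.Empty
  ... | Relation.Nullary.no p  | Relation.Nullary.yes q = Data.Empty.⊥-elim (p (Relation.Binary.PropositionalEquality.sym q))
    where import Data.Empty
  coronaAdj-sym G (inj₂ i) (inj₁ j) with i ≟ j | j ≟ i
  ... | Relation.Nullary.yes _ | Relation.Nullary.yes _ = refl
  ... | Relation.Nullary.no _  | Relation.Nullary.no _  = refl
  ... | Relation.Nullary.yes p | Relation.Nullary.no q  = Data.Empty.⊥-elim (q (Relation.Binary.PropositionalEquality.sym p))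
    where import Data.Empty
  ... | Relation.Nullary.no p  | Relation.Nullary.yes q = Data.Empty.⊥-elim (p (Relation.Binary.PropositionalEquality.sym q))
    where import Data.Empty
  coronaAdj-sym G (inj₂ i) (inj₂ j) = refl

  coronaAdj-irr : ∀ {n} (G : Graph n) x → coronaAdj G x x ≡ false
  coronaAdj-irr G (inj₁ i) = adj-irrefl G i
  coronaAdj-irr G (inj₂ i) = refl

_* : ∀ {n} → Graph n → Graph (n + n)
_* {n} G = record
  { adj = λ x y → coronaAdj G (splitAt n x) (splitAt n y)
  ; adj-sym = λ x y → coronaAdj-sym G (splitAt n x) (splitAt n y)
  ; adj-irrefl = λ x → coronaAdj-irr G (splitAt n x)
  }

subsets : (n : ℕ) → List (Vec Bool n)
subsets zero = [] ∷ []
subsets (suc n) = map (false ∷_) (subsets n) ++ map (true ∷_) (subsets n)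

size : ∀ {n} → Vec Bool n → ℕ
size [] = 0
size (false ∷ s) = size s
size (true ∷ s) = suc (size s)

isStable : ∀ {n} → Graph n → Vec Bool n → Bool
isStable {n} G S =
  and (map (λ i → and (map (λ j → not (lookup S i ∧ lookup S j ∧ adj G i j)) (allFin n))) (allFin n))

stableCount : ∀ {n} → Graph n → ℕ → ℕ
stableCount {n} G k = length (filterᵇ (λ S → isStable G S ∧ (size S ≡ᵇ k)) (subsets n))

-- The independence polynomial I(G;x), represented by its coefficient sequence
-- k ↦ s_k (zero for k > n); two polynomials are equal iff their coefficients are.
I : ∀ {n} → Graph n → ℕ → ℕ
I G = stableCount G

-- (i) An isomorphism φ of coronas sends every pendant edge u_i v_i to a pendant edge, so
-- i ↦ (index of the pendant edge containing φ v_i) is a bijection of the base vertices. It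
-- preserves adjacency: when φ v_i is a pendant u_a, both v_i and v_a must be isolated.
-- (ii) A stable set of G* is a stable set s of G plus any set of pendants avoiding s, so
-- s_k(G*) = Σ_j s_j(G) C(n − j, k − j), i.e. I(G*;x) = Σ_j s_j(G) x^j (1+x)^(n−j). This
-- transformation is unitriangular, hence injective; and s_1 = n recovers the order.
module Submission where

open import Defs
open import Algebra.Properties.CommutativeSemigroup using (interchange)
open import Data.Bool using (Bool; true; false; T; not; _∧_)
open import Data.Bool.Properties using (∧-assoc; ∧-zeroʳ; ∧-identityʳ; T-≡; T-∧; ¬-not)
open import Data.Empty using (⊥; ⊥-elim)
open import Data.Fin using (Fin; splitAt; join) renaming (zero to fzero; suc to fsuc)
open import Data.Fin.Properties using (_≟_; +↔⊎; splitAt-join)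
open import Data.List using (List; []; _∷_; map; length; filterᵇ)
import Data.List as List
open import Data.List.Membership.Propositional.Properties using (∈-allFin)
open import Data.List.Properties using (filter-++; length-++)
import Data.List.Relation.Unary.All as All
open import Data.List.Relation.Unary.All.Properties using (all⁺; all⁻; tabulate⁺)
open import Data.Nat using (ℕ; zero; suc; _+_; _*_; _∸_; _≤_; _<_; _≡ᵇ_; z≤n; s≤s; ⌊_/2⌋)
open import Data.Nat.Induction using (<-rec)
open import Data.Nat.Properties hiding (_≟_)
open import Data.Product using (_×_; _,_; proj₂)
open import Data.Sum using (_⊎_; inj₁; inj₂; [_,_]′; swap; reduce)
open import Data.Sum.Function.Propositional using (_⊎-↔_)
open import Data.Vec using (Vec; []; _∷_; _++_; lookup)
open import Data.Vec.Properties using (lookup-++ˡ; lookup-++ʳ; lookup-splitAt)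
open import Function using (_∘_; case_of_)
open import Function.Bundles using (_↔_; _⇔_; Equivalence; Inverse; Injection; mk↔ₛ′; mk⇔)
open import Function.Definitions using (Injective)
open import Function.Properties.Inverse using (↔-sym; ↔-trans; ↔⇒↣)
open import Relation.Binary.PropositionalEquality
open import Relation.Nullary using (yes; no; does; ¬_)
open import Relation.Nullary.Decidable using (T?; dec-true; dec-false)

-- Isomorphisms of coronas

record _≅ᴿ_ {A B : Set} (R : A → A → Bool) (S : B → B → Bool) : Set where
  field
    bij       : A ↔ B
    preserves : ∀ x y → S (Inverse.to bij x) (Inverse.to bij y) ≡ R x y

≅ᴿ-sym : ∀ {A B : Set} {R : A → A → Bool} {S : B → B → Bool} → R ≅ᴿ S → S ≅ᴿ R
≅ᴿ-sym {S = S} e = record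
  { bij       = ↔-sym bij
  ; preserves = λ x y → trans (sym (preserves (from x) (from y)))
                              (cong₂ S (strictlyInverseˡ x) (strictlyInverseˡ y))
  }
  where open _≅ᴿ_ e; open Inverse bij using (from; strictlyInverseˡ)

≅ᴿ-trans : ∀ {A B C : Set} {R : A → A → Bool} {S : B → B → Bool} {U : C → C → Bool} →
           R ≅ᴿ S → S ≅ᴿ U → R ≅ᴿ U
≅ᴿ-trans e f = record
  { bij       = ↔-trans (_≅ᴿ_.bij e) (_≅ᴿ_.bij f)
  ; preserves = λ x y → trans (_≅ᴿ_.preserves f _ _) (_≅ᴿ_.preserves e x y)
  }

≅⇒≅ᴿ : ∀ {n m} {G : Graph n} {H : Graph m} → G ≅ H → adj G ≅ᴿ adj H
≅⇒≅ᴿ e = record { bij = _≅_.bij e ; preserves = _≅_.preserves e }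

≅ᴿ⇒≅ : ∀ {n m} {G : Graph n} {H : Graph m} → adj G ≅ᴿ adj H → G ≅ H
≅ᴿ⇒≅ e = record { bij = _≅ᴿ_.bij e ; preserves = _≅ᴿ_.preserves e }

*≅ᴿcoronaAdj : ∀ {n} (G : Graph n) → adj (G *) ≅ᴿ coronaAdj G
*≅ᴿcoronaAdj G = record { bij = +↔⊎ ; preserves = λ _ _ → refl }

*-≅⇔coronaAdj-≅ᴿ : ∀ {n m} (G : Graph n) (H : Graph m) → ((G *) ≅ (H *)) ⇔ (coronaAdj G ≅ᴿ coronaAdj H)
*-≅⇔coronaAdj-≅ᴿ G H = mk⇔
  (λ e → ≅ᴿ-trans (≅ᴿ-sym (*≅ᴿcoronaAdj G)) (≅ᴿ-trans (≅⇒≅ᴿ e) (*≅ᴿcoronaAdj H)))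
  (λ c → ≅ᴿ⇒≅ (≅ᴿ-trans (*≅ᴿcoronaAdj G) (≅ᴿ-trans c (≅ᴿ-sym (*≅ᴿcoronaAdj H)))))

does-≟-injective : ∀ {n m} {f : Fin n → Fin m} → Injective _≡_ _≡_ f →
                   ∀ i j → does (f i ≟ f j) ≡ does (i ≟ j)
does-≟-injective {f = f} f-inj i j with i ≟ j
... | yes refl = dec-true (f i ≟ f i) refl
... | no i≢j   = dec-false (f i ≟ f j) (i≢j ∘ f-inj)

≅ᴿ⇒coronaAdj-≅ᴿ : ∀ {n m} {G : Graph n} {H : Graph m} → adj G ≅ᴿ adj H → coronaAdj G ≅ᴿ coronaAdj H
≅ᴿ⇒coronaAdj-≅ᴿ {G = G} {H} e = record { bij = bij ⊎-↔ bij ; preserves = preserves-⊎ }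
  where
  open _≅ᴿ_ e
  φ-injective : Injective _≡_ _≡_ (Inverse.to bij)
  φ-injective = Injection.injective (↔⇒↣ bij)
  preserves-⊎ : ∀ x y → coronaAdj H (Inverse.to (bij ⊎-↔ bij) x) (Inverse.to (bij ⊎-↔ bij) y)
                      ≡ coronaAdj G x y
  preserves-⊎ (inj₁ i) (inj₁ j) = preserves i j
  preserves-⊎ (inj₁ i) (inj₂ j) = does-≟-injective φ-injective i j
  preserves-⊎ (inj₂ i) (inj₁ j) = does-≟-injective φ-injective i j
  preserves-⊎ (inj₂ i) (inj₂ j) = refl

pendant-neighbour : ∀ {n} (G : Graph n) i y → coronaAdj G (inj₂ i) y ≡ true → y ≡ inj₁ i
pendant-neighbour G i (inj₁ j) _ with i ≟ j
... | yes refl = refl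
pendant-neighbour G i (inj₂ j) ()

pendant-edge : ∀ {n} (G : Graph n) i → coronaAdj G (inj₁ i) (inj₂ i) ≡ true
pendant-edge G i = dec-true (i ≟ i) refl

reduce-swap : ∀ {A : Set} (x : A ⊎ A) → reduce (swap x) ≡ reduce x
reduce-swap (inj₁ _) = refl
reduce-swap (inj₂ _) = refl

module CoronaIso {n m} {G : Graph n} {H : Graph m} (c : coronaAdj G ≅ᴿ coronaAdj H) where
  open _≅ᴿ_ c
  open Inverse bij using (strictlyInverseˡ; strictlyInverseʳ)

  φ : Fin n ⊎ Fin n → Fin m ⊎ Fin m
  φ = Inverse.to bij

  ψ : Fin m ⊎ Fin m → Fin n ⊎ Fin n
  ψ = Inverse.from bij

  φ-injective : ∀ {x y} → φ x ≡ φ y → x ≡ y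
  φ-injective = Injection.injective (↔⇒↣ bij)

  transfer : ∀ x y → coronaAdj H (φ x) y ≡ coronaAdj G x (ψ y)
  transfer x y = trans (cong (coronaAdj H (φ x)) (sym (strictlyInverseˡ y))) (preserves x (ψ y))

  -- If φ u_i = v_b, then ψ u_b is a neighbour of u_i, hence v_i.
  φ-pendant : ∀ i → φ (inj₂ i) ≡ swap (φ (inj₁ i))
  φ-pendant i with φ (inj₂ i) in φuᵢ
  ... | inj₂ b = cong swap (sym (pendant-neighbour H b (φ (inj₁ i)) uᵢ~vᵢ))
    where
    uᵢ~vᵢ : coronaAdj H (inj₂ b) (φ (inj₁ i)) ≡ true
    uᵢ~vᵢ = trans (cong (λ z → coronaAdj H z (φ (inj₁ i))) (sym φuᵢ))
                  (trans (preserves (inj₂ i) (inj₁ i)) (pendant-edge G i))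
  ... | inj₁ b = sym (cong swap (trans (cong φ (sym ψuᵦ≡vᵢ)) (strictlyInverseˡ (inj₂ b))))
    where
    ψuᵦ≡vᵢ : ψ (inj₂ b) ≡ inj₁ i
    ψuᵦ≡vᵢ = pendant-neighbour G i (ψ (inj₂ b))
      (trans (sym (transfer (inj₂ i) (inj₂ b)))
             (trans (cong (λ z → coronaAdj H z (inj₂ b)) φuᵢ) (pendant-edge H b)))

  vertexMap : Fin n → Fin m
  vertexMap i = reduce (φ (inj₁ i))

  reduce-φ : ∀ x → reduce (φ x) ≡ vertexMap (reduce x)
  reduce-φ (inj₁ i) = refl
  reduce-φ (inj₂ i) = trans (cong reduce (φ-pendant i)) (reduce-swap (φ (inj₁ i)))

  φv≡u⇒φu≡v : ∀ {i a} → φ (inj₁ i) ≡ inj₂ a → φ (inj₂ i) ≡ inj₁ a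
  φv≡u⇒φu≡v {i} φvᵢ≡uₐ = trans (φ-pendant i) (cong swap φvᵢ≡uₐ)

  φv≡u⇒ψv≡u : ∀ {i a} → φ (inj₁ i) ≡ inj₂ a → ψ (inj₁ a) ≡ inj₂ i
  φv≡u⇒ψv≡u {i} φvᵢ≡uₐ = trans (cong ψ (sym (φv≡u⇒φu≡v φvᵢ≡uₐ))) (strictlyInverseʳ (inj₂ i))

  φv≡u⇒isolated : ∀ {i a} → φ (inj₁ i) ≡ inj₂ a → ∀ j → adj G i j ≡ false
  φv≡u⇒isolated {i} {a} φvᵢ≡uₐ j = ¬-not vᵢ≁vⱼ
    where
    vᵢ≁vⱼ : adj G i j ≢ true
    vᵢ≁vⱼ vᵢ~vⱼ = case φ-injective (trans φvⱼ≡vₐ (sym (φv≡u⇒φu≡v φvᵢ≡uₐ))) of λ ()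
      where
      φvⱼ≡vₐ : φ (inj₁ j) ≡ inj₁ a
      φvⱼ≡vₐ = pendant-neighbour H a (φ (inj₁ j))
        (trans (cong (λ z → coronaAdj H z (φ (inj₁ j))) (sym φvᵢ≡uₐ))
               (trans (preserves (inj₁ i) (inj₁ j)) vᵢ~vⱼ))

coronaAdj-≅ᴿ⇒≅ᴿ : ∀ {n m} {G : Graph n} {H : Graph m} → coronaAdj G ≅ᴿ coronaAdj H → adj G ≅ᴿ adj H
coronaAdj-≅ᴿ⇒≅ᴿ {G = G} {H} c = record
  { bij       = mk↔ₛ′ C.vertexMap C⁻¹.vertexMap vertexMap-inverseˡ vertexMap-inverseʳ
  ; preserves = λ i j → vertexMap-preserves i j refl refl
  }
  where
  module C   = CoronaIso c
  module C⁻¹ = CoronaIso (≅ᴿ-sym c)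
  open Inverse (_≅ᴿ_.bij c) using (strictlyInverseˡ; strictlyInverseʳ)

  vertexMap-inverseˡ : ∀ j → C.vertexMap (C⁻¹.vertexMap j) ≡ j
  vertexMap-inverseˡ j = trans (sym (C.reduce-φ (C.ψ (inj₁ j)))) (cong reduce (strictlyInverseˡ (inj₁ j)))

  vertexMap-inverseʳ : ∀ i → C⁻¹.vertexMap (C.vertexMap i) ≡ i
  vertexMap-inverseʳ i = trans (sym (C⁻¹.reduce-φ (C.φ (inj₁ i)))) (cong reduce (strictlyInverseʳ (inj₁ i)))

  vertexMap-preserves : ∀ i j {x y} → C.φ (inj₁ i) ≡ x → C.φ (inj₁ j) ≡ y →
                        adj H (reduce x) (reduce y) ≡ adj G i j
  vertexMap-preserves i j {inj₁ a} {inj₁ b} φvᵢ φvⱼ =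
    trans (cong₂ (coronaAdj H) (sym φvᵢ) (sym φvⱼ)) (_≅ᴿ_.preserves c (inj₁ i) (inj₁ j))
  vertexMap-preserves i j {inj₂ a} {y} φvᵢ φvⱼ =
    trans (C⁻¹.φv≡u⇒isolated (C.φv≡u⇒ψv≡u φvᵢ) (reduce y)) (sym (C.φv≡u⇒isolated φvᵢ j))
  vertexMap-preserves i j {inj₁ a} {inj₂ b} φvᵢ φvⱼ =
    trans (adj-sym H a b) (trans (C⁻¹.φv≡u⇒isolated (C.φv≡u⇒ψv≡u φvⱼ) a)
                                 (sym (trans (adj-sym G i j) (C.φv≡u⇒isolated φvⱼ i))))

-- Sums over subsets and over ranges

𝟙 : Bool → ℕ
𝟙 true  = 1
𝟙 false = 0

𝟙-∧ : ∀ a b → 𝟙 (a ∧ b) ≡ 𝟙 a * 𝟙 b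
𝟙-∧ true  b = sym (+-identityʳ (𝟙 b))
𝟙-∧ false b = refl

sumSubsets : (n : ℕ) → (Vec Bool n → ℕ) → ℕ
sumSubsets zero    f = f []
sumSubsets (suc n) f = sumSubsets n (f ∘ (false ∷_)) + sumSubsets n (f ∘ (true ∷_))

length-filterᵇ-map : ∀ {A B : Set} (p : B → Bool) (f : A → B) (xs : List A) →
                     length (filterᵇ p (map f xs)) ≡ length (filterᵇ (p ∘ f) xs)
length-filterᵇ-map p f []       = refl
length-filterᵇ-map p f (x ∷ xs) with p (f x)
... | true  = cong suc (length-filterᵇ-map p f xs)
... | false = length-filterᵇ-map p f xs

length-filterᵇ-subsets : ∀ n (p : Vec Bool n → Bool) →
                         length (filterᵇ p (subsets n)) ≡ sumSubsets n (𝟙 ∘ p)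
length-filterᵇ-subsets zero p with p []
... | true  = refl
... | false = refl
length-filterᵇ-subsets (suc n) p = begin
  length (filterᵇ p (branch false List.++ branch true))
    ≡⟨ cong length (filter-++ (T? ∘ p) (branch false) (branch true)) ⟩
  length (filterᵇ p (branch false) List.++ filterᵇ p (branch true))
    ≡⟨ length-++ (filterᵇ p (branch false)) ⟩
  length (filterᵇ p (branch false)) + length (filterᵇ p (branch true))
    ≡⟨ cong₂ _+_ (count false) (count true) ⟩
  sumSubsets (suc n) (𝟙 ∘ p) ∎
  where
  open ≡-Reasoning
  branch : Bool → List (Vec Bool (suc n))
  branch b = map (b ∷_) (subsets n)
  count : ∀ b → length (filterᵇ p (branch b)) ≡ sumSubsets n (𝟙 ∘ p ∘ (b ∷_))
  count b = trans (length-filterᵇ-map p (b ∷_) (subsets n)) (length-filterᵇ-subsets n (p ∘ (b ∷_)))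

sumSubsets-cong : ∀ n {f g : Vec Bool n → ℕ} → (∀ s → f s ≡ g s) → sumSubsets n f ≡ sumSubsets n g
sumSubsets-cong zero    f≗g = f≗g []
sumSubsets-cong (suc n) f≗g =
  cong₂ _+_ (sumSubsets-cong n (f≗g ∘ (false ∷_))) (sumSubsets-cong n (f≗g ∘ (true ∷_)))

sumSubsets-zero : ∀ n → sumSubsets n (λ _ → 0) ≡ 0
sumSubsets-zero zero    = refl
sumSubsets-zero (suc n) = cong₂ _+_ (sumSubsets-zero n) (sumSubsets-zero n)

sumSubsets-+ : ∀ n (f g : Vec Bool n → ℕ) → sumSubsets n (λ s → f s + g s) ≡ sumSubsets n f + sumSubsets n g
sumSubsets-+ zero    f g = refl
sumSubsets-+ (suc n) f g = trans
  (cong₂ _+_ (sumSubsets-+ n (f ∘ (false ∷_)) (g ∘ (false ∷_)))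
             (sumSubsets-+ n (f ∘ (true ∷_)) (g ∘ (true ∷_))))
  (interchange +-commutativeSemigroup (half f false) (half g false) (half f true) (half g true))
  where
  half : (Vec Bool (suc n) → ℕ) → Bool → ℕ
  half h b = sumSubsets n (h ∘ (b ∷_))

sumSubsets-*ˡ : ∀ n c (f : Vec Bool n → ℕ) → sumSubsets n (λ s → c * f s) ≡ c * sumSubsets n f
sumSubsets-*ˡ zero    c f = refl
sumSubsets-*ˡ (suc n) c f = trans
  (cong₂ _+_ (sumSubsets-*ˡ n c (f ∘ (false ∷_))) (sumSubsets-*ˡ n c (f ∘ (true ∷_))))
  (sym (*-distribˡ-+ c (sumSubsets n (f ∘ (false ∷_))) (sumSubsets n (f ∘ (true ∷_)))))

sumSubsets-*ʳ : ∀ n c (f : Vec Bool n → ℕ) → sumSubsets n (λ s → f s * c) ≡ sumSubsets n f * c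
sumSubsets-*ʳ zero    c f = refl
sumSubsets-*ʳ (suc n) c f = trans
  (cong₂ _+_ (sumSubsets-*ʳ n c (f ∘ (false ∷_))) (sumSubsets-*ʳ n c (f ∘ (true ∷_))))
  (sym (*-distribʳ-+ c (sumSubsets n (f ∘ (false ∷_))) (sumSubsets n (f ∘ (true ∷_)))))

sumSubsets-++ : ∀ a b (f : Vec Bool (a + b) → ℕ) →
                sumSubsets (a + b) f ≡ sumSubsets a (λ s → sumSubsets b (λ t → f (s ++ t)))
sumSubsets-++ zero    b f = refl
sumSubsets-++ (suc a) b f = cong₂ _+_ (sumSubsets-++ a b (f ∘ (false ∷_))) (sumSubsets-++ a b (f ∘ (true ∷_)))

sumBelow : ℕ → (ℕ → ℕ) → ℕ
sumBelow zero    f = 0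
sumBelow (suc N) f = sumBelow N f + f N

sumBelow-cong : ∀ N {f g : ℕ → ℕ} → (∀ j → j < N → f j ≡ g j) → sumBelow N f ≡ sumBelow N g
sumBelow-cong zero    f≗g = refl
sumBelow-cong (suc N) f≗g = cong₂ _+_ (sumBelow-cong N (λ j j<N → f≗g j (m<n⇒m<1+n j<N))) (f≗g N ≤-refl)

sumBelow-zero : ∀ N {f : ℕ → ℕ} → (∀ j → j < N → f j ≡ 0) → sumBelow N f ≡ 0
sumBelow-zero zero    f≗0 = refl
sumBelow-zero (suc N) f≗0 = cong₂ _+_ (sumBelow-zero N (λ j j<N → f≗0 j (m<n⇒m<1+n j<N))) (f≗0 N ≤-refl)

sumBelow-*ˡ : ∀ N c (f : ℕ → ℕ) → sumBelow N (λ j → c * f j) ≡ c * sumBelow N f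
sumBelow-*ˡ zero    c f = sym (*-zeroʳ c)
sumBelow-*ˡ (suc N) c f = trans (cong (_+ c * f N) (sumBelow-*ˡ N c f)) (sym (*-distribˡ-+ c (sumBelow N f) (f N)))

sumSubsets-sumBelow : ∀ n N (F : Vec Bool n → ℕ → ℕ) →
                      sumSubsets n (λ s → sumBelow N (F s)) ≡ sumBelow N (λ j → sumSubsets n (λ s → F s j))
sumSubsets-sumBelow n zero    F = sumSubsets-zero n
sumSubsets-sumBelow n (suc N) F = trans (sumSubsets-+ n (λ s → sumBelow N (F s)) (λ s → F s N))
                                        (cong (_+ sumSubsets n (λ s → F s N)) (sumSubsets-sumBelow n N F))

sumBelow-truncate : ∀ {N k} {f : ℕ → ℕ} → k < N → (∀ j → k < j → f j ≡ 0) →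
                    sumBelow N f ≡ sumBelow k f + f k
sumBelow-truncate {suc N} {k} {f} k<1+N f≗0 with m<1+n⇒m<n∨m≡n k<1+N
... | inj₁ k<N  = trans (cong (sumBelow N f +_) (f≗0 N k<N)) (trans (+-identityʳ _) (sumBelow-truncate k<N f≗0))
... | inj₂ refl = refl

sumBelow-single : ∀ {N k} {f : ℕ → ℕ} → k < N → (∀ j → j ≢ k → f j ≡ 0) → sumBelow N f ≡ f k
sumBelow-single {k = k} {f} k<N f≗0 =
  trans (sumBelow-truncate k<N (λ j k<j → f≗0 j (>⇒≢ k<j)))
        (cong (_+ f k) (sumBelow-zero k (λ j j<k → f≗0 j (<⇒≢ j<k))))

unitriangular-injective : ∀ N (c : ℕ → ℕ → ℕ) → (∀ k → c k k ≡ 1) → (∀ j k → k < j → c j k ≡ 0) →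
  ∀ {a b : ℕ → ℕ} → (∀ k → N ≤ k → a k ≡ 0) → (∀ k → N ≤ k → b k ≡ 0) →
  (∀ k → sumBelow N (λ j → a j * c j k) ≡ sumBelow N (λ j → b j * c j k)) → ∀ k → a k ≡ b k
unitriangular-injective N c diag upper {a} {b} a≗0 b≗0 same = <-rec _ step
  where
  row : ∀ {k} (x : ℕ → ℕ) → k < N →
        sumBelow N (λ j → x j * c j k) ≡ sumBelow k (λ j → x j * c j k) + x k * c k k
  row {k} x k<N = sumBelow-truncate k<N (λ j k<j → trans (cong (x j *_) (upper j k k<j)) (*-zeroʳ (x j)))

  step : ∀ k → (∀ {j} → j < k → a j ≡ b j) → a k ≡ b k
  step k ih with N ≤? k
  ... | yes N≤k = trans (a≗0 k N≤k) (sym (b≗0 k N≤k))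
  ... | no  N≰k = begin
    a k            ≡⟨ sym (*-identityʳ (a k)) ⟩
    a k * 1        ≡⟨ cong (a k *_) (sym (diag k)) ⟩
    a k * c k k    ≡⟨ +-cancelˡ-≡ (sumBelow k (λ j → b j * c j k)) _ _ last-terms ⟩
    b k * c k k    ≡⟨ cong (b k *_) (diag k) ⟩
    b k * 1        ≡⟨ *-identityʳ (b k) ⟩
    b k            ∎
    where
    open ≡-Reasoning
    k<N = ≰⇒> N≰k
    last-terms : sumBelow k (λ j → b j * c j k) + a k * c k k ≡ sumBelow k (λ j → b j * c j k) + b k * c k k
    last-terms = begin
      sumBelow k (λ j → b j * c j k) + a k * c k k
        ≡⟨ cong (_+ a k * c k k) (sumBelow-cong k (λ j j<k → cong (λ x → x * c j k) (sym (ih j<k)))) ⟩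
      sumBelow k (λ j → a j * c j k) + a k * c k k ≡⟨ sym (row a k<N) ⟩
      sumBelow N (λ j → a j * c j k)               ≡⟨ same k ⟩
      sumBelow N (λ j → b j * c j k)               ≡⟨ row b k<N ⟩
      sumBelow k (λ j → b j * c j k) + b k * c k k ∎

-- Stable sets of a corona

T-injective : ∀ {a b} → (T a → T b) → (T b → T a) → a ≡ b
T-injective {false} {false} _ _ = refl
T-injective {false} {true}  _ b⇒a = ⊥-elim (b⇒a _)
T-injective {true}  {false} a⇒b _ = ⊥-elim (a⇒b _)
T-injective {true}  {true}  _ _ = refl

Stable : ∀ {n} → Graph n → Vec Bool n → Set
Stable G S = ∀ i j → T (lookup S i) → T (lookup S j) → adj G i j ≡ false

T-not-∧∧ : ∀ {a b c} → T (not (a ∧ b ∧ c)) ⇔ (T a → T b → c ≡ false)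
T-not-∧∧ {false}                = mk⇔ (λ _ ()) _
T-not-∧∧ {true} {false}         = mk⇔ (λ _ _ ()) _
T-not-∧∧ {true} {true} {false}  = mk⇔ (λ _ _ _ → refl) _
T-not-∧∧ {true} {true} {true}   = mk⇔ (λ ()) (λ c≡false → case c≡false _ _ of λ ())

isStable-sound : ∀ {n} (G : Graph n) S → T (isStable G S) → Stable G S
isStable-sound G S h i j = Equivalence.to T-not-∧∧
  (All.lookup (all⁺ _ _ (All.lookup (all⁺ _ _ h) (∈-allFin i))) (∈-allFin j))

isStable-complete : ∀ {n} (G : Graph n) S → Stable G S → T (isStable G S)
isStable-complete G S st =
  all⁻ _ (tabulate⁺ λ i → all⁻ _ (tabulate⁺ λ j → Equivalence.from T-not-∧∧ (st i j)))

disjoint : ∀ {n} → Vec Bool n → Vec Bool n → Bool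
disjoint []      []      = true
disjoint (a ∷ s) (b ∷ t) = not (a ∧ b) ∧ disjoint s t

Disjoint : ∀ {n} → Vec Bool n → Vec Bool n → Set
Disjoint s t = ∀ i → T (lookup s i) → T (lookup t i) → ⊥

disjoint-sound : ∀ {n} (s t : Vec Bool n) → T (disjoint s t) → Disjoint s t
disjoint-sound (true ∷ s) (true ∷ t) () fzero
disjoint-sound (a ∷ s) (b ∷ t) h (fsuc i) = disjoint-sound s t (proj₂ (Equivalence.to (T-∧ {not (a ∧ b)}) h)) i

disjoint-complete : ∀ {n} (s t : Vec Bool n) → Disjoint s t → T (disjoint s t)
disjoint-complete []      []      _  = _
disjoint-complete (a ∷ s) (b ∷ t) dj =
  Equivalence.from T-∧ (head a b (dj fzero) , disjoint-complete s t (dj ∘ fsuc))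
  where
  head : ∀ a b → (T a → T b → ⊥) → T (not (a ∧ b))
  head false _     _  = _
  head true  false _  = _
  head true  true  ab = ab _ _

module _ {n} (G : Graph n) (s t : Vec Bool n) where

  private
    L : Fin n ⊎ Fin n → Bool
    L = [ lookup s , lookup t ]′

  CoronaStable : Set
  CoronaStable = ∀ u v → T (L u) → T (L v) → coronaAdj G u v ≡ false

  lookup-++-join : ∀ u → lookup (s ++ t) (join n n u) ≡ L u
  lookup-++-join (inj₁ i) = lookup-++ˡ s t i
  lookup-++-join (inj₂ j) = lookup-++ʳ s t j

  Stable-*⇒CoronaStable : Stable (G *) (s ++ t) → CoronaStable
  Stable-*⇒CoronaStable h u v su sv =
    subst₂ (λ u′ v′ → coronaAdj G u′ v′ ≡ false) (splitAt-join n n u) (splitAt-join n n v)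
      (h (join n n u) (join n n v) (subst T (sym (lookup-++-join u)) su) (subst T (sym (lookup-++-join v)) sv))

  CoronaStable⇒Stable-* : CoronaStable → Stable (G *) (s ++ t)
  CoronaStable⇒Stable-* h x y sx sy =
    h (splitAt n x) (splitAt n y) (subst T (lookup-splitAt n s t x) sx) (subst T (lookup-splitAt n s t y) sy)

  CoronaStable⇒Stable×Disjoint : CoronaStable → Stable G s × Disjoint s t
  CoronaStable⇒Stable×Disjoint h =
    (λ i j → h (inj₁ i) (inj₁ j)) ,
    (λ i si ti → case trans (sym (h (inj₁ i) (inj₂ i) si ti)) (pendant-edge G i) of λ ())

  Stable×Disjoint⇒CoronaStable : Stable G s → Disjoint s t → CoronaStable
  Stable×Disjoint⇒CoronaStable st dj (inj₁ i) (inj₁ j) si sj = st i j si sj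
  Stable×Disjoint⇒CoronaStable st dj (inj₁ i) (inj₂ j) si tj with i ≟ j
  ... | yes refl = ⊥-elim (dj i si tj)
  ... | no _     = refl
  Stable×Disjoint⇒CoronaStable st dj (inj₂ i) (inj₁ j) ti sj with i ≟ j
  ... | yes refl = ⊥-elim (dj i sj ti)
  ... | no _     = refl
  Stable×Disjoint⇒CoronaStable st dj (inj₂ i) (inj₂ j) _  _  = refl

  isStable-corona : isStable (G *) (s ++ t) ≡ isStable G s ∧ disjoint s t
  isStable-corona = T-injective
    (λ h → let st , dj = CoronaStable⇒Stable×Disjoint (Stable-*⇒CoronaStable (isStable-sound (G *) (s ++ t) h))
           in Equivalence.from T-∧ (isStable-complete G s st , disjoint-complete s t dj))
    (λ h → let st , dj = Equivalence.to T-∧ h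
           in isStable-complete (G *) (s ++ t) (CoronaStable⇒Stable-*
                (Stable×Disjoint⇒CoronaStable (isStable-sound G s st) (disjoint-sound s t dj))))

size-++ : ∀ {a b} (s : Vec Bool a) (t : Vec Bool b) → size (s ++ t) ≡ size s + size t
size-++ []          t = refl
size-++ (false ∷ s) t = size-++ s t
size-++ (true ∷ s)  t = cong suc (size-++ s t)

size≤length : ∀ {n} (s : Vec Bool n) → size s ≤ n
size≤length []          = z≤n
size≤length (false ∷ s) = m≤n⇒m≤1+n (size≤length s)
size≤length (true ∷ s)  = s≤s (size≤length s)

≡ᵇ-true : ∀ {m n} → m ≡ n → (m ≡ᵇ n) ≡ true
≡ᵇ-true {m} {n} m≡n = Equivalence.to T-≡ (≡⇒≡ᵇ m n m≡n)

≡ᵇ-false : ∀ {m n} → m ≢ n → (m ≡ᵇ n) ≡ false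
≡ᵇ-false {m} {n} m≢n = ¬-not (m≢n ∘ ≡ᵇ⇒≡ m n ∘ Equivalence.from T-≡)

-- extensions m a k = C(m, k − a), and 0 when k < a
extensions : ℕ → ℕ → ℕ → ℕ
extensions m a k = sumSubsets m (λ t → 𝟙 (a + size t ≡ᵇ k))

extensions-suc : ∀ m a k → extensions (suc m) a k ≡ extensions m a k + extensions m (suc a) k
extensions-suc m a k =
  cong (extensions m a k +_) (sumSubsets-cong m (λ t → cong (λ x → 𝟙 (x ≡ᵇ k)) (+-suc a (size t))))

extensions-above : ∀ m {a k} → k < a → extensions m a k ≡ 0
extensions-above m {a} {k} k<a = trans
  (sumSubsets-cong m (λ t → cong 𝟙 (≡ᵇ-false (>⇒≢ (<-≤-trans k<a (m≤m+n a (size t)))))))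
  (sumSubsets-zero m)

extensions-diag : ∀ m k → extensions m k k ≡ 1
extensions-diag zero    k = cong 𝟙 (≡ᵇ-true (+-identityʳ k))
extensions-diag (suc m) k = begin
  extensions (suc m) k k                         ≡⟨ extensions-suc m k k ⟩
  extensions m k k + extensions m (suc k) k      ≡⟨ cong₂ _+_ (extensions-diag m k) (extensions-above m (n<1+n k)) ⟩
  1                                              ∎
  where open ≡-Reasoning

extensions-singletons : ∀ m → extensions m 0 1 ≡ m
extensions-singletons zero    = refl
extensions-singletons (suc m) = begin
  extensions (suc m) 0 1                  ≡⟨ extensions-suc m 0 1 ⟩
  extensions m 0 1 + extensions m 1 1     ≡⟨ cong₂ _+_ (extensions-singletons m) (extensions-diag m 1) ⟩
  m + 1                                   ≡⟨ +-comm m 1 ⟩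
  suc m                                   ∎
  where open ≡-Reasoning

sumSubsets-disjoint : ∀ {n} (s : Vec Bool n) a k →
  sumSubsets n (λ t → 𝟙 (disjoint s t ∧ (a + size t ≡ᵇ k))) ≡ extensions (n ∸ size s) a k
sumSubsets-disjoint []                a k = refl
sumSubsets-disjoint {suc n} (true ∷ s)  a k =
  trans (cong₂ _+_ (sumSubsets-disjoint s a k) (sumSubsets-zero n)) (+-identityʳ _)
sumSubsets-disjoint {suc n} (false ∷ s) a k = begin
  sumSubsets n (λ t → 𝟙 (disjoint s t ∧ (a + size t ≡ᵇ k)))
    + sumSubsets n (λ t → 𝟙 (disjoint s t ∧ (a + suc (size t) ≡ᵇ k)))
    ≡⟨ cong (sumSubsets n (λ t → 𝟙 (disjoint s t ∧ (a + size t ≡ᵇ k))) +_)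
            (sumSubsets-cong n (λ t → cong (λ x → 𝟙 (disjoint s t ∧ (x ≡ᵇ k))) (+-suc a (size t)))) ⟩
  sumSubsets n (λ t → 𝟙 (disjoint s t ∧ (a + size t ≡ᵇ k)))
    + sumSubsets n (λ t → 𝟙 (disjoint s t ∧ (suc a + size t ≡ᵇ k)))
    ≡⟨ cong₂ _+_ (sumSubsets-disjoint s a k) (sumSubsets-disjoint s (suc a) k) ⟩
  extensions (n ∸ size s) a k + extensions (n ∸ size s) (suc a) k
    ≡⟨ sym (extensions-suc (n ∸ size s) a k) ⟩
  extensions (suc (n ∸ size s)) a k
    ≡⟨ cong (λ m → extensions m a k) (sym (+-∸-assoc 1 (size≤length s))) ⟩
  extensions (suc n ∸ size s) a k ∎
  where open ≡-Reasoning

sumBelow-select : ∀ {N a} (W : ℕ → ℕ) → a < N → sumBelow N (λ j → 𝟙 (a ≡ᵇ j) * W j) ≡ W a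
sumBelow-select {a = a} W a<N = trans
  (sumBelow-single a<N (λ j j≢a → cong (λ b → 𝟙 b * W j) (≡ᵇ-false (j≢a ∘ sym))))
  (trans (cong (λ b → 𝟙 b * W a) (≡ᵇ-true {a} refl)) (+-identityʳ (W a)))

sumSubsets-bySize : ∀ n (p : Vec Bool n → Bool) (W : ℕ → ℕ) →
  sumSubsets n (λ s → 𝟙 (p s) * W (size s)) ≡
  sumBelow (suc n) (λ j → sumSubsets n (λ s → 𝟙 (p s ∧ (size s ≡ᵇ j))) * W j)
sumSubsets-bySize n p W = begin
  sumSubsets n (λ s → 𝟙 (p s) * W (size s))
    ≡⟨ sumSubsets-cong n spread ⟩
  sumSubsets n (λ s → sumBelow (suc n) (λ j → 𝟙 (p s ∧ (size s ≡ᵇ j)) * W j))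
    ≡⟨ sumSubsets-sumBelow n (suc n) (λ s j → 𝟙 (p s ∧ (size s ≡ᵇ j)) * W j) ⟩
  sumBelow (suc n) (λ j → sumSubsets n (λ s → 𝟙 (p s ∧ (size s ≡ᵇ j)) * W j))
    ≡⟨ sumBelow-cong (suc n) (λ j _ → sumSubsets-*ʳ n (W j) (λ s → 𝟙 (p s ∧ (size s ≡ᵇ j)))) ⟩
  sumBelow (suc n) (λ j → sumSubsets n (λ s → 𝟙 (p s ∧ (size s ≡ᵇ j))) * W j) ∎
  where
  open ≡-Reasoning
  spread : ∀ s → 𝟙 (p s) * W (size s) ≡ sumBelow (suc n) (λ j → 𝟙 (p s ∧ (size s ≡ᵇ j)) * W j)
  spread s = begin
    𝟙 (p s) * W (size s)
      ≡⟨ cong (𝟙 (p s) *_) (sym (sumBelow-select W (s≤s (size≤length s)))) ⟩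
    𝟙 (p s) * sumBelow (suc n) (λ j → 𝟙 (size s ≡ᵇ j) * W j)
      ≡⟨ sym (sumBelow-*ˡ (suc n) (𝟙 (p s)) (λ j → 𝟙 (size s ≡ᵇ j) * W j)) ⟩
    sumBelow (suc n) (λ j → 𝟙 (p s) * (𝟙 (size s ≡ᵇ j) * W j))
      ≡⟨ sumBelow-cong (suc n) (λ j _ → trans (sym (*-assoc (𝟙 (p s)) _ (W j)))
                                             (cong (λ x → x * W j) (sym (𝟙-∧ (p s) (size s ≡ᵇ j))))) ⟩
    sumBelow (suc n) (λ j → 𝟙 (p s ∧ (size s ≡ᵇ j)) * W j) ∎

stableCount-sumSubsets : ∀ {n} (G : Graph n) k →
  stableCount G k ≡ sumSubsets n (λ S → 𝟙 (isStable G S ∧ (size S ≡ᵇ k)))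
stableCount-sumSubsets {n} G k = length-filterᵇ-subsets n _

stableCount-corona : ∀ {n} (G : Graph n) k →
  stableCount (G *) k ≡ sumBelow (suc n) (λ j → stableCount G j * extensions (n ∸ j) j k)
stableCount-corona {n} G k = begin
  stableCount (G *) k
    ≡⟨ stableCount-sumSubsets (G *) k ⟩
  sumSubsets (n + n) (λ S → 𝟙 (isStable (G *) S ∧ (size S ≡ᵇ k)))
    ≡⟨ sumSubsets-++ n n _ ⟩
  sumSubsets n (λ s → sumSubsets n (λ t → 𝟙 (isStable (G *) (s ++ t) ∧ (size (s ++ t) ≡ᵇ k))))
    ≡⟨ sumSubsets-cong n extend ⟩
  sumSubsets n (λ s → 𝟙 (isStable G s) * extensions (n ∸ size s) (size s) k)
    ≡⟨ sumSubsets-bySize n (isStable G) (λ j → extensions (n ∸ j) j k) ⟩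
  sumBelow (suc n) (λ j → sumSubsets n (λ s → 𝟙 (isStable G s ∧ (size s ≡ᵇ j))) * extensions (n ∸ j) j k)
    ≡⟨ sumBelow-cong (suc n) (λ j _ → cong (λ x → x * extensions (n ∸ j) j k)
                                          (sym (stableCount-sumSubsets G j))) ⟩
  sumBelow (suc n) (λ j → stableCount G j * extensions (n ∸ j) j k) ∎
  where
  open ≡-Reasoning
  split : ∀ s t → 𝟙 (isStable (G *) (s ++ t) ∧ (size (s ++ t) ≡ᵇ k))
                ≡ 𝟙 (isStable G s) * 𝟙 (disjoint s t ∧ (size s + size t ≡ᵇ k))
  split s t = begin
    𝟙 (isStable (G *) (s ++ t) ∧ (size (s ++ t) ≡ᵇ k))
      ≡⟨ cong₂ (λ b x → 𝟙 (b ∧ (x ≡ᵇ k))) (isStable-corona G s t) (size-++ s t) ⟩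
    𝟙 ((isStable G s ∧ disjoint s t) ∧ (size s + size t ≡ᵇ k))
      ≡⟨ cong 𝟙 (∧-assoc (isStable G s) (disjoint s t) _) ⟩
    𝟙 (isStable G s ∧ (disjoint s t ∧ (size s + size t ≡ᵇ k)))
      ≡⟨ 𝟙-∧ (isStable G s) _ ⟩
    𝟙 (isStable G s) * 𝟙 (disjoint s t ∧ (size s + size t ≡ᵇ k)) ∎
  extend : ∀ s → sumSubsets n (λ t → 𝟙 (isStable (G *) (s ++ t) ∧ (size (s ++ t) ≡ᵇ k)))
               ≡ 𝟙 (isStable G s) * extensions (n ∸ size s) (size s) k
  extend s = begin
    sumSubsets n (λ t → 𝟙 (isStable (G *) (s ++ t) ∧ (size (s ++ t) ≡ᵇ k)))
      ≡⟨ sumSubsets-cong n (split s) ⟩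
    sumSubsets n (λ t → 𝟙 (isStable G s) * 𝟙 (disjoint s t ∧ (size s + size t ≡ᵇ k)))
      ≡⟨ sumSubsets-*ˡ n (𝟙 (isStable G s)) _ ⟩
    𝟙 (isStable G s) * sumSubsets n (λ t → 𝟙 (disjoint s t ∧ (size s + size t ≡ᵇ k)))
      ≡⟨ cong (𝟙 (isStable G s) *_) (sumSubsets-disjoint s (size s) k) ⟩
    𝟙 (isStable G s) * extensions (n ∸ size s) (size s) k ∎

size≡0⇒empty : ∀ {n} (S : Vec Bool n) → size S ≡ 0 → ∀ i → ¬ T (lookup S i)
size≡0⇒empty (false ∷ S) size≡0 (fsuc i) = size≡0⇒empty S size≡0 i

size≡1⇒unique : ∀ {n} (S : Vec Bool n) → size S ≡ 1 → ∀ i j → T (lookup S i) → T (lookup S j) → i ≡ j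
size≡1⇒unique (true ∷ S)  _      fzero    fzero    _  _  = refl
size≡1⇒unique (true ∷ S)  size≡1 fzero    (fsuc j) _  Sj =
  ⊥-elim (size≡0⇒empty S (suc-injective size≡1) j Sj)
size≡1⇒unique (true ∷ S)  size≡1 (fsuc i) _        Si _  =
  ⊥-elim (size≡0⇒empty S (suc-injective size≡1) i Si)
size≡1⇒unique (false ∷ S) size≡1 (fsuc i) (fsuc j) Si Sj = cong fsuc (size≡1⇒unique S size≡1 i j Si Sj)

stableCount-one : ∀ {n} (G : Graph n) → stableCount G 1 ≡ n
stableCount-one {n} G = begin
  stableCount G 1                                         ≡⟨ stableCount-sumSubsets G 1 ⟩
  sumSubsets n (λ S → 𝟙 (isStable G S ∧ (size S ≡ᵇ 1)))   ≡⟨ sumSubsets-cong n (cong 𝟙 ∘ singletons-stable) ⟩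
  extensions n 0 1                                        ≡⟨ extensions-singletons n ⟩
  n                                                       ∎
  where
  open ≡-Reasoning
  singletons-stable : ∀ S → isStable G S ∧ (size S ≡ᵇ 1) ≡ (size S ≡ᵇ 1)
  singletons-stable S with size S ≡ᵇ 1 in size≡ᵇ1
  ... | false = ∧-zeroʳ (isStable G S)
  ... | true  = trans (∧-identityʳ (isStable G S)) (Equivalence.to T-≡ (isStable-complete G S single))
    where
    single : Stable G S
    single i j Si Sj = subst (λ j → adj G i j ≡ false)
      (size≡1⇒unique S (≡ᵇ⇒≡ _ 1 (Equivalence.from T-≡ size≡ᵇ1)) i j Si Sj) (adj-irrefl G i)

stableCount-vanishes : ∀ {n} (G : Graph n) k → n < k → stableCount G k ≡ 0
stableCount-vanishes {n} G k n<k = begin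
  stableCount G k                                         ≡⟨ stableCount-sumSubsets G k ⟩
  sumSubsets n (λ S → 𝟙 (isStable G S ∧ (size S ≡ᵇ k)))   ≡⟨ sumSubsets-cong n too-large ⟩
  sumSubsets n (λ _ → 0)                                  ≡⟨ sumSubsets-zero n ⟩
  0                                                       ∎
  where
  open ≡-Reasoning
  too-large : ∀ S → 𝟙 (isStable G S ∧ (size S ≡ᵇ k)) ≡ 0
  too-large S =
    trans (cong (λ b → 𝟙 (isStable G S ∧ b)) (≡ᵇ-false (<⇒≢ (≤-<-trans (size≤length S) n<k))))
          (cong 𝟙 (∧-zeroʳ (isStable G S)))

I≗⇒order≡ : ∀ {n m} (G : Graph n) (H : Graph m) → (∀ k → I G k ≡ I H k) → n ≡ m
I≗⇒order≡ G H I≗ = trans (sym (stableCount-one G)) (trans (I≗ 1) (stableCount-one H))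

I≗⇒I*≗ : ∀ {n m} (G : Graph n) (H : Graph m) → (∀ k → I G k ≡ I H k) → ∀ k → I (G *) k ≡ I (H *) k
I≗⇒I*≗ {n} G H I≗ k with refl ← I≗⇒order≡ G H I≗ =
  trans (stableCount-corona G k)
        (trans (sumBelow-cong (suc n) (λ j _ → cong (λ x → x * extensions (n ∸ j) j k) (I≗ j)))
               (sym (stableCount-corona H k)))

n+n≡m+m⇒n≡m : ∀ {n m} → n + n ≡ m + m → n ≡ m
n+n≡m+m⇒n≡m {n} {m} e = trans (n≡⌊n+n/2⌋ n) (trans (cong ⌊_/2⌋ e) (sym (n≡⌊n+n/2⌋ m)))

I*≗⇒I≗ : ∀ {n m} (G : Graph n) (H : Graph m) → (∀ k → I (G *) k ≡ I (H *) k) → ∀ k → I G k ≡ I H k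
I*≗⇒I≗ {n} {m} G H I*≗ with refl ← n+n≡m+m⇒n≡m {n} {m} (I≗⇒order≡ (G *) (H *) I*≗) =
  unitriangular-injective (suc n) (λ j k → extensions (n ∸ j) j k)
    (λ k → extensions-diag (n ∸ k) k) (λ j k → extensions-above (n ∸ j))
    (stableCount-vanishes G) (stableCount-vanishes H)
    (λ k → trans (sym (stableCount-corona G k)) (trans (I*≗ k) (stableCount-corona H k)))

corollary3 : ∀ {n m} (G : Graph n) (H : Graph m) →
    ((G ≅ H) ⇔ ((G *) ≅ (H *))) × (((k : ℕ) → I G k ≡ I H k) ⇔ ((k : ℕ) → I (G *) k ≡ I (H *) k))
corollary3 G H =
  mk⇔ (λ G≅H → Equivalence.from (*-≅⇔coronaAdj-≅ᴿ G H) (≅ᴿ⇒coronaAdj-≅ᴿ (≅⇒≅ᴿ G≅H)))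
      (λ G*≅H* → ≅ᴿ⇒≅ (coronaAdj-≅ᴿ⇒≅ᴿ (Equivalence.to (*-≅⇔coronaAdj-≅ᴿ G H) G*≅H*)))
  , mk⇔ (I≗⇒I*≗ G H) (I*≗⇒I≗ G H)
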